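{- Let $(B_+,\mathcal C_+,B_-,\mathcal C_-;\mathsf{con}_1,\mathsf{tot}_1)$ be a presentation of a pre-d-frame with generated pre-d-frame $(L_+,L_-;\mathsf{Con}_*,\mathsf{Tot}_*)$. Then $\mathsf{Con}_*=\bigcup_{\iota\in\mathrm{Ord}}\mathcal D^\iota(\downarrow\mathsf{con}_{\wedge,\vee})$ and $\mathsf{Tot}_*=\uparrow\mathsf{tot}_{\wedge,\vee}$.
   Context: A frame presentation $(B,\mathcal C)$: $B$ a meet-semilattice with top, $\mathcal C$ a set of pairs $U\dashv a$ ($a\in B$, $U\subseteq\downarrow a$) with $U\dashv a\in\mathcal C$, $b\le a\Rightarrow\{u\wedge b:u\in U\}\dashv b\in\mathcal C$. $\mathcal C$-ideals are downsets $I\subseteq B$ with $U\dashv a\in\mathcal C,U\subseteq I\Rightarrow a\in I$; they form a frame under inclusion. A presentation of a pre-d-frame is $(B_+,\mathcal C_+,B_-,\mathcal C_-;\mathsf{con}_1,\mathsf{tot}_1)$ with $(B_\pm,\mathcal C_\pm)$ frame presentations and $\mathsf{con}_1,\mathsf{tot}_1\subseteq B_+\times B_-$. $L_\pm$ is the frame of $\mathcal C_\pm$-ideals; $b\in B_\pm$ is identified with the smallest $\mathcal C_\pm$-ideal containing it, so $\mathsf{con}_1,\mathsf{tot}_1\subseteq L_+\times L_-$. On $L_+\times L_-$: $\alpha\sqsubseteq\beta$ iff $\alpha_+\le\beta_+,\alpha_-\le\beta_-$; logical join $\alpha\vee\beta=(\alpha_+\vee\beta_+,\alpha_-\wedge\beta_-)$,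 meet $\alpha\wedge\beta=(\alpha_+\wedge\beta_+,\alpha_-\vee\beta_-)$; $tt=(1,0)$, $ff=(0,1)$. $\mathsf{Con}_*$ is the smallest relation containing $\mathsf{con}_1,tt,ff$ that is $\sqsubseteq$-downward closed, closed under logical $\wedge,\vee$ and coordinatewise joins of $\sqsubseteq$-directed sets; $\mathsf{Tot}_*$ is the smallest containing $\mathsf{tot}_1,tt,ff$ that is $\sqsubseteq$-upward closed and closed under logical $\wedge,\vee$. $\mathsf{con}_{\wedge,\vee}$ (resp. $\mathsf{tot}_{\wedge,\vee}$) is the closure of $\mathsf{con}_1$ (resp. $\mathsf{tot}_1$) under all finite logical meets and joins. $\downarrow,\uparrow$ are $\sqsubseteq$-downward/upward closures. $\mathcal D(R)=\{(\bigvee_{\alpha\in A}\alpha_+,\bigvee_{\alpha\in A}\alpha_-): A\subseteq R\ \sqsubseteq\text{ -directed}\}$; $\mathcal D^0(R)=R$, $\mathcal D^{\iota+1}(R)=\mathcal D(\mathcal D^\iota(R))$, $\mathcal D^\lambda(R)=\bigcup_{\iota<\lambda}\mathcal D^\iota(R)$ for limit ordinals $\lambda$. -}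

module Defs where

open import Level using (0ℓ)
open import Data.Empty using (⊥)
open import Data.Unit using (⊤; tt)
open import Data.Sum using (_⊎_; inj₁; inj₂)
open import Data.Product using (Σ; _×_; _,_; proj₁; proj₂; ∃)
open import Relation.Binary.Lattice.Bundles using (BoundedMeetSemilattice)

-- The covering relation 𝒞 is given
-- as a family: for each a ∈ B, a type  Cov a  of (names of) covers of a,
-- and for i : Cov a the subset  cov i ⊆ B  (the set U with U ⊣ a ∈ 𝒞).

record FramePresentation : Set₁ where
  field
    B   : BoundedMeetSemilattice 0ℓ 0ℓ 0ℓ
  open BoundedMeetSemilattice B public renaming (⊤ to top)
  field
    Cov : Carrier → Set
    cov : ∀ {a} → Cov a → Carrier → Set
    cov-below : ∀ {a} (i : Cov a) u → cov i u → u ≤ a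
    stable : ∀ {a b} (i : Cov a) → b ≤ a →
             Σ (Cov b) λ j → ∀ x →
               (cov j x → Σ Carrier λ u → cov i u × x ≈ (u ∧ b)) ×
               ((Σ Carrier λ u → cov i u × x ≈ (u ∧ b)) → cov j x)

module FrameOf (F : FramePresentation) where
  open FramePresentation F

  record Ideal : Set₁ where
    field
      mem    : Carrier → Set
      down   : ∀ {x y} → y ≤ x → mem x → mem y
      closed : ∀ {a} (i : Cov a) → (∀ u → cov i u → mem u) → mem a
  open Ideal public

  data Gen (S : Carrier → Set) : Carrier → Set where
    inc   : ∀ {x} → S x → Gen S x
    down≤ : ∀ {x y} → y ≤ x → Gen S x → Gen S y
    cov-c : ∀ {a} (i : Cov a) → (∀ u → cov i u → Gen S u) → Gen S a

  gen : (Carrier → Set) → Ideal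
  gen S = record { mem = Gen S ; down = down≤ ; closed = cov-c }

  _≤L_ : Ideal → Ideal → Set
  I ≤L J = ∀ x → mem I x → mem J x

  emb : Carrier → Ideal
  emb b = gen (λ x → x ≈ b)

  0L : Ideal
  0L = gen (λ _ → ⊥)

  1L : Ideal
  1L = record { mem = λ _ → ⊤ ; down = λ _ _ → tt ; closed = λ _ _ → tt }

  _∨L_ : Ideal → Ideal → Ideal
  I ∨L J = gen (λ x → mem I x ⊎ mem J x)

  _∧L_ : Ideal → Ideal → Ideal
  I ∧L J = record
    { mem    = λ x → mem I x × mem J x
    ; down   = λ y≤x p → down I y≤x (proj₁ p) , down J y≤x (proj₂ p)
    ; closed = λ i h → closed I i (λ u c → proj₁ (h u c))
                     , closed J i (λ u c → proj₂ (h u c))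
    }

  ⋁L : {X : Set} → (X → Ideal) → Ideal
  ⋁L {X} f = gen (λ x → Σ X λ k → mem (f k) x)

record PreDFramePresentation : Set₁ where
  field
    P N  : FramePresentation
    con₁ : FramePresentation.Carrier P → FramePresentation.Carrier N → Set
    tot₁ : FramePresentation.Carrier P → FramePresentation.Carrier N → Set

-- Brouwer ordinals (limits indexed by arbitrary small types)
data Ord : Set₁ where
  zero : Ord
  suc  : Ord → Ord
  lim  : {X : Set} → (X → Ord) → Ord

module Generated (𝒫 : PreDFramePresentation) where
  open PreDFramePresentation 𝒫
  module L₊ = FrameOf P
  module L₋ = FrameOf N

  Pair : Set₁
  Pair = L₊.Ideal × L₋.Ideal

  _⊑_ : Pair → Pair → Set
  α ⊑ β = L₊._≤L_ (proj₁ α) (proj₁ β) × L₋._≤L_ (proj₂ α) (proj₂ β)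

  _≈P_ : Pair → Pair → Set
  α ≈P β = (α ⊑ β) × (β ⊑ α)

  _∨ₗ_ : Pair → Pair → Pair
  α ∨ₗ β = L₊._∨L_ (proj₁ α) (proj₁ β) , L₋._∧L_ (proj₂ α) (proj₂ β)

  _∧ₗ_ : Pair → Pair → Pair
  α ∧ₗ β = L₊._∧L_ (proj₁ α) (proj₁ β) , L₋._∨L_ (proj₂ α) (proj₂ β)

  ttP ffP : Pair
  ttP = L₊.1L , L₋.0L
  ffP = L₊.0L , L₋.1L

  embP : FramePresentation.Carrier P → FramePresentation.Carrier N → Pair
  embP p q = L₊.emb p , L₋.emb q

  Directed : {X : Set} → (X → Pair) → Set
  Directed {X} f = Σ X (λ _ → ⊤) ×
    (∀ i j → Σ X λ k → (f i ⊑ f k) × (f j ⊑ f k))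

  ⋁P : {X : Set} → (X → Pair) → Pair
  ⋁P f = L₊.⋁L (λ k → proj₁ (f k)) , L₋.⋁L (λ k → proj₂ (f k))

  data Con* : Pair → Set₁ where
    base : ∀ {p q} → con₁ p q → Con* (embP p q)
    c-tt : Con* ttP
    c-ff : Con* ffP
    c-↓  : ∀ {α β} → α ⊑ β → Con* β → Con* α
    c-∧  : ∀ {α β} → Con* α → Con* β → Con* (α ∧ₗ β)
    c-∨  : ∀ {α β} → Con* α → Con* β → Con* (α ∨ₗ β)
    c-⋁  : {X : Set} (f : X → Pair) → Directed f →
           (∀ k → Con* (f k)) → Con* (⋁P f)

  data Tot* : Pair → Set₁ where
    base : ∀ {p q} → tot₁ p q → Tot* (embP p q)
    t-tt : Tot* ttP
    t-ff : Tot* ffP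
    t-↑  : ∀ {α β} → α ⊑ β → Tot* α → Tot* β
    t-∧  : ∀ {α β} → Tot* α → Tot* β → Tot* (α ∧ₗ β)
    t-∨  : ∀ {α β} → Tot* α → Tot* β → Tot* (α ∨ₗ β)

  -- closure of a relation r ⊆ B₊ × B₋ under all finite logical meets
  -- and joins (the empty meet is tt, the empty join is ff)
  data Fin∧∨ (r : FramePresentation.Carrier P → FramePresentation.Carrier N → Set)
       : Pair → Set₁ where
    base : ∀ {p q} → r p q → Fin∧∨ r (embP p q)
    f-tt : Fin∧∨ r ttP
    f-ff : Fin∧∨ r ffP
    f-∧  : ∀ {α β} → Fin∧∨ r α → Fin∧∨ r β → Fin∧∨ r (α ∧ₗ β)
    f-∨  : ∀ {α β} → Fin∧∨ r α → Fin∧∨ r β → Fin∧∨ r (α ∨ₗ β)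

  con∧∨ tot∧∨ : Pair → Set₁
  con∧∨ = Fin∧∨ con₁
  tot∧∨ = Fin∧∨ tot₁

  ↓_ ↑_ : (Pair → Set₁) → Pair → Set₁
  (↓ R) α = Σ Pair λ β → R β × (α ⊑ β)
  (↑ R) α = Σ Pair λ β → R β × (β ⊑ α)

  𝒟 : (Pair → Set₁) → Pair → Set₁
  𝒟 R α = Σ Set λ X → Σ (X → Pair) λ f →
            (∀ k → R (f k)) × Directed f × (α ≈P ⋁P f)

  𝒟^ : Ord → (Pair → Set₁) → Pair → Set₁
  𝒟^ zero    R = R
  𝒟^ (suc ι) R = 𝒟 (𝒟^ ι R)
  𝒟^ (lim {X} f) R α = Σ X λ k → 𝒟^ (f k) R α

  ⋃𝒟^ : (Pair → Set₁) → Pair → Set₁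
  ⋃𝒟^ R α = Σ Ord λ ι → 𝒟^ ι R α

  _≐_ : (Pair → Set₁) → (Pair → Set₁) → Set₁
  R ≐ S = ∀ α → (R α → S α) × (S α → R α)

-- Tot* is the least up-closed relation containing tot₁, tt, ff and closed
-- under ∧ₗ and ∨ₗ; since ∧ₗ and ∨ₗ are monotone, ↑ tot∧∨ already has all
-- these closure properties. For Con* the same holds for ↓ con∧∨ except for
-- directed joins, which are added transfinitely. The point is that the
-- iterates ⋃𝒟^ R stay closed under ∧ₗ and ∨ₗ: both operations preserve
-- directed joins in each argument, because ideals of a frame presentation
-- satisfy the frame distributive law (this is where stability of covers
-- under restriction is used), while joins distribute over the inhabited
-- joins of directed families.
module Submission where

open import Defs
open import Data.Product using (_×_; _,_; proj₁; proj₂)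
open import Data.Sum using (inj₁; inj₂)
open import Relation.Binary.Lattice.Properties.MeetSemilattice using (∧-monotonic)

module IdealLattice (F : FramePresentation) where
  open FramePresentation F
  open FrameOf F

  gen-least : ∀ {S} (I : Ideal) → (∀ x → S x → mem I x) → gen S ≤L I
  gen-least I S⊆I x (inc s)        = S⊆I x s
  gen-least I S⊆I x (down≤ y≤x g)  = down I y≤x (gen-least I S⊆I _ g)
  gen-least I S⊆I x (cov-c i covd) = closed I i (λ u c → gen-least I S⊆I u (covd u c))

  ⋁L-least : ∀ {X} (J : X → Ideal) (I : Ideal) → (∀ k → J k ≤L I) → ⋁L J ≤L I
  ⋁L-least J I J≤I = gen-least I (λ x (k , m) → J≤I k x m)

  ∧L-mono : ∀ {I I′ J J′} → I ≤L I′ → J ≤L J′ → (I ∧L J) ≤L (I′ ∧L J′)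
  ∧L-mono I≤I′ J≤J′ x (mI , mJ) = I≤I′ x mI , J≤J′ x mJ

  ∨L-mono : ∀ {I I′ J J′} → I ≤L I′ → J ≤L J′ → (I ∨L J) ≤L (I′ ∨L J′)
  ∨L-mono {I′ = I′} {J′ = J′} I≤I′ J≤J′ = gen-least (I′ ∨L J′) λ where
    x (inj₁ m) → inc (inj₁ (I≤I′ x m))
    x (inj₂ m) → inc (inj₂ (J≤J′ x m))

  ∧L-comm : ∀ I J → (I ∧L J) ≤L (J ∧L I)
  ∧L-comm I J x (mI , mJ) = mJ , mI

  ∨L-comm : ∀ I J → (I ∨L J) ≤L (J ∨L I)
  ∨L-comm I J = gen-least (J ∨L I) λ where
    x (inj₁ m) → inc (inj₂ m)
    x (inj₂ m) → inc (inj₁ m)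

  -- Induction on the generation of x ∈ ⋁ J; a cover of a is restricted to
  -- a cover of a ∧ y by stability.
  ∧-mem-⋁L-distrib : ∀ {X} (J : X → Ideal) (I : Ideal) {x y} →
    mem (⋁L J) x → mem I y → mem (⋁L (λ k → I ∧L J k)) (x ∧ y)
  ∧-mem-⋁L-distrib J I (inc (k , mx)) my =
    inc (k , down I (x∧y≤y _ _) my , down (J k) (x∧y≤x _ _) mx)
  ∧-mem-⋁L-distrib J I (down≤ x≤x′ g) my =
    down≤ (∧-monotonic meetSemilattice x≤x′ refl) (∧-mem-⋁L-distrib J I g my)
  ∧-mem-⋁L-distrib J I {a} {y} (cov-c i covd) my =
    let (j , restrict) = stable i (x∧y≤x a y) in
    cov-c j λ v v∈j →
      let (u , u∈i , v≈u∧a∧y) = proj₁ (restrict v) v∈j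
          v≤u∧y = trans (reflexive v≈u∧a∧y) (∧-monotonic meetSemilattice refl (x∧y≤y a y))
      in down≤ v≤u∧y (∧-mem-⋁L-distrib J I (covd u u∈i) my)

  ∧L-⋁L-distribˡ : (I : Ideal) {X : Set} (J : X → Ideal) →
    (I ∧L ⋁L J) ≤L ⋁L (λ k → I ∧L J k)
  ∧L-⋁L-distribˡ I J x (mI , m⋁J) =
    down≤ (∧-greatest refl refl) (∧-mem-⋁L-distrib J I m⋁J mI)

  ∨L-⋁L-distribˡ : (I : Ideal) {X : Set} (J : X → Ideal) → X →
    (I ∨L ⋁L J) ≤L ⋁L (λ k → I ∨L J k)
  ∨L-⋁L-distribˡ I J k₀ = gen-least (⋁L (λ k → I ∨L J k)) λ where
    x (inj₁ m) → inc (k₀ , inc (inj₁ m))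
    x (inj₂ m) → ⋁L-least J (⋁L (λ k → I ∨L J k))
                   (λ k z n → inc (k , inc (inj₂ n))) x m

module _ (𝒫 : PreDFramePresentation) where
  open PreDFramePresentation 𝒫
  open Generated 𝒫
  module I₊ = IdealLattice P
  module I₋ = IdealLattice N

  ⊑-refl : ∀ α → α ⊑ α
  ⊑-refl α = (λ x m → m) , (λ x m → m)

  ⊑-trans : ∀ α β γ → α ⊑ β → β ⊑ γ → α ⊑ γ
  ⊑-trans α β γ (α≤β₊ , α≤β₋) (β≤γ₊ , β≤γ₋) =
    (λ x m → β≤γ₊ x (α≤β₊ x m)) , (λ x m → β≤γ₋ x (α≤β₋ x m))

  Monotone : (Pair → Pair) → Set₁
  Monotone op = ∀ α β → α ⊑ β → op α ⊑ op β

  Monotone₂ : (Pair → Pair → Pair) → Set₁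
  Monotone₂ _·_ = ∀ α α′ β β′ → α ⊑ α′ → β ⊑ β′ → (α · β) ⊑ (α′ · β′)

  ∧ₗ-mono : Monotone₂ _∧ₗ_
  ∧ₗ-mono (α₊ , α₋) (α₊′ , α₋′) (β₊ , β₋) (β₊′ , β₋′) (α≤₊ , α≤₋) (β≤₊ , β≤₋) =
    I₊.∧L-mono {α₊} {α₊′} {β₊} {β₊′} α≤₊ β≤₊ ,
    I₋.∨L-mono {α₋} {α₋′} {β₋} {β₋′} α≤₋ β≤₋

  ∨ₗ-mono : Monotone₂ _∨ₗ_
  ∨ₗ-mono (α₊ , α₋) (α₊′ , α₋′) (β₊ , β₋) (β₊′ , β₋′) (α≤₊ , α≤₋) (β≤₊ , β≤₋) =
    I₊.∨L-mono {α₊} {α₊′} {β₊} {β₊′} α≤₊ β≤₊ ,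
    I₋.∧L-mono {α₋} {α₋′} {β₋} {β₋′} α≤₋ β≤₋

  ∧ₗ-comm : ∀ α β → (α ∧ₗ β) ⊑ (β ∧ₗ α)
  ∧ₗ-comm (α₊ , α₋) (β₊ , β₋) = I₊.∧L-comm α₊ β₊ , I₋.∨L-comm α₋ β₋

  ∨ₗ-comm : ∀ α β → (α ∨ₗ β) ⊑ (β ∨ₗ α)
  ∨ₗ-comm (α₊ , α₋) (β₊ , β₋) = I₊.∨L-comm α₊ β₊ , I₋.∧L-comm α₋ β₋

  ∧ₗ-⋁P-distribˡ : ∀ α {X} (f : X → Pair) → Directed f →
    (α ∧ₗ ⋁P f) ⊑ ⋁P (λ k → α ∧ₗ f k)
  ∧ₗ-⋁P-distribˡ (α₊ , α₋) f ((k₀ , _) , _) =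
    I₊.∧L-⋁L-distribˡ α₊ (λ k → proj₁ (f k)) ,
    I₋.∨L-⋁L-distribˡ α₋ (λ k → proj₂ (f k)) k₀

  ∨ₗ-⋁P-distribˡ : ∀ α {X} (f : X → Pair) → Directed f →
    (α ∨ₗ ⋁P f) ⊑ ⋁P (λ k → α ∨ₗ f k)
  ∨ₗ-⋁P-distribˡ (α₊ , α₋) f ((k₀ , _) , _) =
    I₊.∨L-⋁L-distribˡ α₊ (λ k → proj₁ (f k)) k₀ ,
    I₋.∧L-⋁L-distribˡ α₋ (λ k → proj₂ (f k))

  Directed-map : ∀ op → Monotone op → ∀ {X} (f : X → Pair) →
    Directed f → Directed (λ k → op (f k))
  Directed-map op mono f (inhabited , bound) =
    inhabited , λ i j → let (k , fi⊑fk , fj⊑fk) = bound i j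
                        in k , mono (f i) (f k) fi⊑fk , mono (f j) (f k) fj⊑fk

  -- The meet for ⊑, not the logical meet ∧ₗ.
  _⊓_ : Pair → Pair → Pair
  (α₊ , α₋) ⊓ (β₊ , β₋) = L₊._∧L_ α₊ β₊ , L₋._∧L_ α₋ β₋

  ⊓-monoʳ : ∀ α → Monotone (α ⊓_)
  ⊓-monoʳ α β γ (β≤₊ , β≤₋) =
    (λ x (mα , mβ) → mα , β≤₊ x mβ) , (λ x (mα , mβ) → mα , β≤₋ x mβ)

  ⊓-lowerʳ : ∀ α β → (α ⊓ β) ⊑ β
  ⊓-lowerʳ α β = (λ x → proj₂) , (λ x → proj₂)

  ⊑⋁P⇒≈⋁P⊓ : ∀ α {X} (f : X → Pair) → α ⊑ ⋁P f → α ≈P ⋁P (λ k → α ⊓ f k)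
  ⊑⋁P⇒≈⋁P⊓ (α₊ , α₋) f (α≤₊ , α≤₋) =
    ( (λ x m → I₊.∧L-⋁L-distribˡ α₊ (λ k → proj₁ (f k)) x (m , α≤₊ x m))
    , (λ x m → I₋.∧L-⋁L-distribˡ α₋ (λ k → proj₂ (f k)) x (m , α≤₋ x m)) )
    , ( I₊.⋁L-least (λ k → L₊._∧L_ α₊ (proj₁ (f k))) α₊ (λ k x → proj₁)
      , I₋.⋁L-least (λ k → L₋._∧L_ α₋ (proj₂ (f k))) α₋ (λ k x → proj₁) )

  DownClosed : (Pair → Set₁) → Set₁
  DownClosed R = ∀ α β → α ⊑ β → R β → R α

  module Iterates {R : Pair → Set₁} (R-down : DownClosed R) where

    𝒟^-down-closed : ∀ ι → DownClosed (𝒟^ ι R)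
    𝒟^-down-closed zero    = R-down
    𝒟^-down-closed (lim o) α β α⊑β (k , d) = k , 𝒟^-down-closed (o k) α β α⊑β d
    𝒟^-down-closed (suc ι) α β α⊑β (X , f , f∈ , dir , (β⊑⋁f , _)) =
      X , (λ k → α ⊓ f k) ,
      (λ k → 𝒟^-down-closed ι (α ⊓ f k) (f k) (⊓-lowerʳ α (f k)) (f∈ k)) ,
      Directed-map (α ⊓_) (⊓-monoʳ α) f dir ,
      ⊑⋁P⇒≈⋁P⊓ α f (⊑-trans α β (⋁P f) α⊑β β⊑⋁f)

    ⋃𝒟^-down-closed : DownClosed (⋃𝒟^ R)
    ⋃𝒟^-down-closed α β α⊑β (ι , d) = ι , 𝒟^-down-closed ι α β α⊑β d

    ⋃𝒟^-⋁P-closed : ∀ {X} (f : X → Pair) → Directed f →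
      (∀ k → ⋃𝒟^ R (f k)) → ⋃𝒟^ R (⋁P f)
    ⋃𝒟^-⋁P-closed {X} f dir f∈ =
      suc (lim (λ k → proj₁ (f∈ k))) ,
      X , f , (λ k → k , proj₂ (f∈ k)) , dir , (⊑-refl (⋁P f) , ⊑-refl (⋁P f))

    ⋃𝒟^-preserved : (op : Pair → Pair) → Monotone op →
      (∀ {X} (f : X → Pair) → Directed f → op (⋁P f) ⊑ ⋁P (λ k → op (f k))) →
      (∀ α → R α → ⋃𝒟^ R (op α)) → ∀ α → ⋃𝒟^ R α → ⋃𝒟^ R (op α)
    ⋃𝒟^-preserved op mono op-⋁P R→ α (ι , d) = go ι α d
      where
      go : ∀ ι α → 𝒟^ ι R α → ⋃𝒟^ R (op α)
      go zero    α r       = R→ α r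
      go (lim o) α (k , d) = go (o k) α d
      go (suc ι) α (X , f , f∈ , dir , (α⊑⋁f , _)) =
        ⋃𝒟^-down-closed (op α) (⋁P op∘f) opα⊑⋁op∘f
          (⋃𝒟^-⋁P-closed op∘f (Directed-map op mono f dir) (λ k → go ι (f k) (f∈ k)))
        where
        op∘f : X → Pair
        op∘f k = op (f k)

        opα⊑⋁op∘f : op α ⊑ ⋁P op∘f
        opα⊑⋁op∘f = ⊑-trans (op α) (op (⋁P f)) (⋁P op∘f) (mono α (⋁P f) α⊑⋁f) (op-⋁P f dir)

    -- Preservation in the right argument is used twice; commutativity moves
    -- the already-iterated argument to the right.
    ⋃𝒟^-closed₂ : (_·_ : Pair → Pair → Pair) → Monotone₂ _·_ →
      (∀ α β → (α · β) ⊑ (β · α)) →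
      (∀ α {X} (f : X → Pair) → Directed f → (α · ⋁P f) ⊑ ⋁P (λ k → α · f k)) →
      (∀ α β → R α → R β → R (α · β)) →
      ∀ α β → ⋃𝒟^ R α → ⋃𝒟^ R β → ⋃𝒟^ R (α · β)
    ⋃𝒟^-closed₂ _·_ mono comm distrib R-closed α β a b =
      ⋃𝒟^-preserved (α ·_) (monoʳ α) (distrib α) right-in-R β b
      where
      monoʳ : ∀ ζ → Monotone (ζ ·_)
      monoʳ ζ γ δ = mono ζ ζ γ δ (⊑-refl ζ)

      right-in-R : ∀ ζ → R ζ → ⋃𝒟^ R (α · ζ)
      right-in-R ζ rζ =
        ⋃𝒟^-down-closed (α · ζ) (ζ · α) (comm α ζ)
          (⋃𝒟^-preserved (ζ ·_) (monoʳ ζ) (distrib ζ)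
            (λ ξ rξ → zero , R-closed ζ ξ rζ rξ) α a)

  ↓-down-closed : ∀ S → DownClosed (↓ S)
  ↓-down-closed S α β α⊑β (γ , sγ , β⊑γ) = γ , sγ , ⊑-trans α β γ α⊑β β⊑γ

  ↓-closed₂ : ∀ S _·_ → Monotone₂ _·_ → (∀ {α β} → S α → S β → S (α · β)) →
    ∀ α β → (↓ S) α → (↓ S) β → (↓ S) (α · β)
  ↓-closed₂ S _·_ mono S-closed α β (α′ , sα′ , α⊑α′) (β′ , sβ′ , β⊑β′) =
    α′ · β′ , S-closed sα′ sβ′ , mono α α′ β β′ α⊑α′ β⊑β′

  ↑-closed₂ : ∀ S _·_ → Monotone₂ _·_ → (∀ {α β} → S α → S β → S (α · β)) →
    ∀ α β → (↑ S) α → (↑ S) β → (↑ S) (α · β)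
  ↑-closed₂ S _·_ mono S-closed α β (α′ , sα′ , α′⊑α) (β′ , sβ′ , β′⊑β) =
    α′ · β′ , S-closed sα′ sβ′ , mono α′ α β′ β α′⊑α β′⊑β

  Fin∧∨-least : ∀ {r} (S : Pair → Set₁) →
    (∀ {p q} → r p q → S (embP p q)) → S ttP → S ffP →
    (∀ {α β} → S α → S β → S (α ∧ₗ β)) → (∀ {α β} → S α → S β → S (α ∨ₗ β)) →
    ∀ {α} → Fin∧∨ r α → S α
  Fin∧∨-least {r} S s-base s-tt s-ff s-∧ s-∨ = go
    where
    go : ∀ {α} → Fin∧∨ r α → S α
    go (base x)  = s-base x
    go f-tt      = s-tt
    go f-ff      = s-ff
    go (f-∧ a b) = s-∧ (go a) (go b)
    go (f-∨ a b) = s-∨ (go a) (go b)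

  Fin∧∨⊆↓ : ∀ {r α} → Fin∧∨ r α → (↓ Fin∧∨ r) α
  Fin∧∨⊆↓ {α = α} s = α , s , ⊑-refl α

  Fin∧∨⊆↑ : ∀ {r α} → Fin∧∨ r α → (↑ Fin∧∨ r) α
  Fin∧∨⊆↑ {α = α} s = α , s , ⊑-refl α

  open Iterates (↓-down-closed con∧∨)

  Con*⊆⋃𝒟^ : ∀ {α} → Con* α → ⋃𝒟^ (↓ con∧∨) α
  Con*⊆⋃𝒟^ (base c)          = zero , Fin∧∨⊆↓ (base c)
  Con*⊆⋃𝒟^ c-tt              = zero , Fin∧∨⊆↓ f-tt
  Con*⊆⋃𝒟^ c-ff              = zero , Fin∧∨⊆↓ f-ff
  Con*⊆⋃𝒟^ (c-↓ {α} {β} α⊑β c) = ⋃𝒟^-down-closed α β α⊑β (Con*⊆⋃𝒟^ c)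
  Con*⊆⋃𝒟^ (c-∧ {α} {β} a b) =
    ⋃𝒟^-closed₂ _∧ₗ_ ∧ₗ-mono ∧ₗ-comm ∧ₗ-⋁P-distribˡ (↓-closed₂ con∧∨ _∧ₗ_ ∧ₗ-mono f-∧)
      α β (Con*⊆⋃𝒟^ a) (Con*⊆⋃𝒟^ b)
  Con*⊆⋃𝒟^ (c-∨ {α} {β} a b) =
    ⋃𝒟^-closed₂ _∨ₗ_ ∨ₗ-mono ∨ₗ-comm ∨ₗ-⋁P-distribˡ (↓-closed₂ con∧∨ _∨ₗ_ ∨ₗ-mono f-∨)
      α β (Con*⊆⋃𝒟^ a) (Con*⊆⋃𝒟^ b)
  Con*⊆⋃𝒟^ (c-⋁ f dir fs)    = ⋃𝒟^-⋁P-closed f dir (λ k → Con*⊆⋃𝒟^ (fs k))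

  𝒟^⊆Con* : ∀ ι {α} → 𝒟^ ι (↓ con∧∨) α → Con* α
  𝒟^⊆Con* zero (β , c , α⊑β) = c-↓ α⊑β (Fin∧∨-least Con* base c-tt c-ff c-∧ c-∨ c)
  𝒟^⊆Con* (suc ι) (X , f , f∈ , dir , (α⊑⋁f , _)) =
    c-↓ α⊑⋁f (c-⋁ f dir (λ k → 𝒟^⊆Con* ι (f∈ k)))
  𝒟^⊆Con* (lim o) (k , d) = 𝒟^⊆Con* (o k) d

  Tot*⊆↑ : ∀ {α} → Tot* α → (↑ tot∧∨) α
  Tot*⊆↑ (base t)            = Fin∧∨⊆↑ (base t)
  Tot*⊆↑ t-tt                = Fin∧∨⊆↑ f-tt
  Tot*⊆↑ t-ff                = Fin∧∨⊆↑ f-ff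
  Tot*⊆↑ (t-↑ {α} {β} α⊑β t) =
    let (γ , sγ , γ⊑α) = Tot*⊆↑ t in γ , sγ , ⊑-trans γ α β γ⊑α α⊑β
  Tot*⊆↑ (t-∧ {α} {β} a b)   = ↑-closed₂ tot∧∨ _∧ₗ_ ∧ₗ-mono f-∧ α β (Tot*⊆↑ a) (Tot*⊆↑ b)
  Tot*⊆↑ (t-∨ {α} {β} a b)   = ↑-closed₂ tot∧∨ _∨ₗ_ ∨ₗ-mono f-∨ α β (Tot*⊆↑ a) (Tot*⊆↑ b)

  ↑⊆Tot* : ∀ {α} → (↑ tot∧∨) α → Tot* α
  ↑⊆Tot* (β , t , β⊑α) = t-↑ β⊑α (Fin∧∨-least Tot* base t-tt t-ff t-∧ t-∨ t)

corollary6 : (𝒫 : PreDFramePresentation) →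
    let open Generated 𝒫 in
    (Con* ≐ ⋃𝒟^ (↓ con∧∨)) × (Tot* ≐ (↑ tot∧∨))
corollary6 𝒫 =
  (λ α → Con*⊆⋃𝒟^ 𝒫 , λ (ι , d) → 𝒟^⊆Con* 𝒫 ι d) ,
  (λ α → Tot*⊆↑ 𝒫 , ↑⊆Tot* 𝒫)
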